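{- Let $B$ be a finite nonempty index set, $P,Q$ a partition of $B$ (disjoint, $P\cup Q=B$), and $g:\{0,1\}^B\to\{0,1\}$. Consider the procedure WhereIsTheLiteral$(g,P,Q)$: draw independent uniform $w\in\{0,1\}^Q$, $z\in\{0,1\}^P$; if $g(w\circ z)\ne g(w\circ z^{(P)})$, return $(w\circ z,\,w\circ z^{(P)})$ as a distinguishing pair for $P$; otherwise draw independent uniform $w'\in\{0,1\}^P$, $z'\in\{0,1\}^Q$; if $g(w'\circ z')\ne g(w'\circ z'^{(Q)})$, return $(w'\circ z',\,w'\circ z'^{(Q)})$ as a distinguishing pair for $Q$; otherwise return ``fail''. Suppose $g$ is $\gamma$-close, with respect to the uniform distribution on $\{0,1\}^B$, to a literal $x_i$ or $\overline{x_i}$ for some $i\in B$. If $i\in P$, then the procedure returns a distinguishing pair of $g$ for $P$ with probability at least $1-4\gamma$; if $i\in Q$, then it returns a distinguishing pair of $g$ for $Q$ with probability at least $1-4\gamma$.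
   Context: For $z\in\{0,1\}^P$, $z^{(P)}$ denotes $z$ with all coordinates flipped; $w\circ z$ denotes the string in $\{0,1\}^B$ agreeing with $w$ on $Q$ and $z$ on $P$. A distinguishing pair of $g$ for a block $S\subseteq B$ is a pair $(x,y)$ with $x$ and $y$ agreeing on $B\setminus S$ and $g(x)\ne g(y)$. $g$ is $\gamma$-close to a function $h$ under the uniform distribution if $\Pr_{x}[g(x)\ne h(x)]\le\gamma$ for $x$ uniform on $\{0,1\}^B$.
   Formalization: The closeness parameter γ ranges over the rationals. -}

module Defs where

open import Data.Nat using (ℕ; zero; suc; _^_; _*_)
open import Data.Nat.Properties using (m^n≢0)
open import Data.Bool using (Bool; true; false; not; if_then_else_; _∧_; _∨_)
open import Data.Fin using (Fin)
import Data.Vec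
open import Data.Vec using (Vec; []; _∷_; lookup; tabulate; map)
open import Data.List using (List; []; _∷_; _++_; length; filter; concatMap)
import Data.List as L
open import Data.Product using (_×_; _,_)
open import Data.Bool.Properties using () renaming (_≟_ to _≟ᵇ_)
open import Relation.Nullary.Decidable using (does)
open import Data.Integer using (+_)
open import Data.Rational using (ℚ; _/_; _≤_)
open import Relation.Binary.PropositionalEquality using (_≡_)

-- Strings in {0,1}^B, with B = Fin n.
Str : ℕ → Set
Str n = Vec Bool n

-- A block S ⊆ B, as a characteristic vector (true = member).
Block : ℕ → Set
Block n = Vec Bool n

compl : ∀ {n} → Block n → Block n
compl = map not

_==_ : Bool → Bool → Bool
a == b = does (a ≟ᵇ b)

allStr : (n : ℕ) → List (Str n)
allStr zero = [] ∷ []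
allStr (suc n) = concatMap (λ v → (false ∷ v) ∷ (true ∷ v) ∷ []) (allStr n)

-- w ∘ z : agrees with w off S and with z on S.
-- (w and z are given as full-length strings; only w's coordinates outside S
--  and z's coordinates in S are used.)
comb : ∀ {n} → Block n → Str n → Str n → Str n
comb S w z = tabulate (λ i → if lookup S i then lookup z i else lookup w i)

flipOn : ∀ {n} → Block n → Str n → Str n
flipOn S z = tabulate (λ i → if lookup S i then not (lookup z i) else lookup z i)

agreeOff : ∀ {n} → Block n → Str n → Str n → Bool
agreeOff {n} S x y = Data.Vec.foldr _ _∧_ true (tabulate (λ i → lookup S i ∨ (lookup x i == lookup y i)))

isDistPair : ∀ {n} → (Str n → Bool) → Block n → Str n → Str n → Bool
isDistPair g S x y = agreeOff S x y ∧ not (g x == g y)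

data Outcome (n : ℕ) : Set where
  pairP : Str n → Str n → Outcome n
  pairQ : Str n → Str n → Outcome n
  fail  : Outcome n

-- WhereIsTheLiteral(g,P,Q) run on random seeds (w, z, w', z'):
--  w ∈ {0,1}^Q, z ∈ {0,1}^P, w' ∈ {0,1}^P, z' ∈ {0,1}^Q.
whereIsTheLiteral : ∀ {n} → (Str n → Bool) → (P : Block n) →
                    Str n → Str n → Str n → Str n → Outcome n
whereIsTheLiteral g P w z w' z' =
  let Q  = compl P
      a  = comb P w z
      a' = comb P w (flipOn P z)
      b  = comb Q w' z'
      b' = comb Q w' (flipOn Q z')
  in if not (g a == g a') then pairP a a'
     else (if not (g b == g b') then pairQ b b' else fail)

allSeeds : (n : ℕ) → List (Str n × Str n × Str n × Str n)
allSeeds n = concatMap (λ w → concatMap (λ z → concatMap (λ w' → L.map (λ z' → (w , z , w' , z'))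
               (allStr n)) (allStr n)) (allStr n)) (allStr n)

returnsDistP : ∀ {n} → (Str n → Bool) → Block n → Outcome n → Bool
returnsDistP g P (pairP x y) = isDistPair g P x y
returnsDistP g P (pairQ x y) = false
returnsDistP g P fail        = false

returnsDistQ : ∀ {n} → (Str n → Bool) → Block n → Outcome n → Bool
returnsDistQ g P (pairP x y) = false
returnsDistQ g P (pairQ x y) = isDistPair g (compl P) x y
returnsDistQ g P fail        = false

countSeeds : ∀ n → (Outcome n → Bool) → (Str n → Bool) → Block n → ℕ
countSeeds n E g P = length (filter (λ s → E' s ≟ᵇ true) (allSeeds n))
  where
  E' : Str n × Str n × Str n × Str n → Bool
  E' (w , z , w' , z') = E (whereIsTheLiteral g P w z w' z')

probSeeds : ∀ n → (Outcome n → Bool) → (Str n → Bool) → Block n → ℚ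
probSeeds n E g P = _/_ (+ countSeeds n E g P) (2 ^ (4 * n)) {{m^n≢0 2 (4 * n)}}

literal : ∀ {n} → Fin n → Bool → Str n → Bool
literal i true  x = lookup x i
literal i false x = not (lookup x i)

dist : ∀ n → (Str n → Bool) → (Str n → Bool) → ℚ
dist n g h = _/_ (+ length (filter (λ x → g x ≟ᵇ not (h x)) (allStr n))) (2 ^ n) {{m^n≢0 2 n}}

close : ∀ n → ℚ → (Str n → Bool) → (Str n → Bool) → Set
close n γ g h = dist n g h ≤ γ

-- Let h be the literal and call x a mismatch when g x ≠ h x.  Each of the four
-- query points w ∘ z, w ∘ z^(P), w' ∘ z', w' ∘ z'^(Q) is uniformly distributed
-- (summing f (w ∘ z^(M)) over all w, z gives 2^n ∑ₓ f x), so each is a mismatch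
-- with probability at most γ.  If i ∈ P, h differs on the first two queries, so unless
-- one of them is a mismatch, g differs on them too and they form a distinguishing
-- pair for P.  If i ∈ Q, h agrees on the first two queries and differs on the last
-- two, so unless one of the four is a mismatch, the first test fails and the second
-- one succeeds.  A union bound over the four queries bounds the failure
-- probability by 4γ.

module Submission where

open import Defs
open import Data.Bool using (Bool; true; false; not; if_then_else_; _∧_; _xor_)
open import Data.Bool.Properties using (∧-idem) renaming (_≟_ to _≟ᵇ_)
open import Data.Fin using (Fin)
open import Data.List using (List; []; _∷_; _++_; map; concatMap; filter; length)
open import Data.List.Properties using (map-++)
open import Data.Integer as ℤ using (+_)
import Data.Integer.Properties as ℤ
open import Data.Nat as ℕ using (ℕ; zero; suc; _+_; _*_; _^_; _≤_; z≤n; s≤s; NonZero)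
import Data.Nat.Properties as ℕ
open import Data.Nat.ListAction using (sum)
open import Data.Nat.ListAction.Properties using (sum-++)
open import Data.Product using (_×_; _,_)
open import Data.Vec using ([]; _∷_; lookup; replicate)
open import Data.Vec.Properties using (lookup∘tabulate; lookup-map)
open import Relation.Binary.PropositionalEquality
open import Relation.Nullary.Decidable using (does)
open import Relation.Unary using (Pred; Decidable)
import Data.Nat.Tactic.RingSolver as ℕ-Solver
import Data.Integer.Tactic.RingSolver as ℤ-Solver
open import Data.Rational as ℚ using (ℚ; 1ℚ; toℚᵘ)
import Data.Rational.Properties as ℚ
open import Data.Rational.Unnormalised as ℚᵘ using (mkℚᵘ; *≤*; *≡*; 1ℚᵘ)
import Data.Rational.Unnormalised.Properties as ℚᵘ

toℕ : Bool → ℕ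
toℕ false = 0
toℕ true  = 1

does-≟-true : ∀ b → does (b ≟ᵇ true) ≡ b
does-≟-true false = refl
does-≟-true true  = refl

does-≟-not : ∀ x y → does (x ≟ᵇ not y) ≡ x xor y
does-≟-not false false = refl
does-≟-not false true  = refl
does-≟-not true  false = refl
does-≟-not true  true  = refl

not-== : ∀ x y → not (x == y) ≡ x xor y
not-== false false = refl
not-== false true  = refl
not-== true  false = refl
not-== true  true  = refl

xor-triangle : ∀ x y u → toℕ (x xor y) ≤ toℕ (x xor u) + toℕ (y xor u)
xor-triangle false false u     = z≤n
xor-triangle true  true  u     = z≤n
xor-triangle false true  false = s≤s z≤n
xor-triangle false true  true  = s≤s z≤n
xor-triangle true  false false = s≤s z≤n
xor-triangle true  false true  = s≤s z≤n

xor-cover : ∀ x y u → 1 ≤ toℕ (x xor y) + toℕ (x xor u) + toℕ (y xor not u)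
xor-cover false true  u     = s≤s z≤n
xor-cover true  false u     = s≤s z≤n
xor-cover false false false = s≤s z≤n
xor-cover false false true  = s≤s z≤n
xor-cover true  true  false = s≤s z≤n
xor-cover true  true  true  = s≤s z≤n


∑ : {A : Set} → List A → (A → ℕ) → ℕ
∑ xs f = sum (map f xs)

syntax ∑ xs (λ x → e) = ∑[ x ∈ xs ] e

module _ {A : Set} where

  ∑-cong : ∀ (xs : List A) {f g : A → ℕ} → (∀ x → f x ≡ g x) → ∑ xs f ≡ ∑ xs g
  ∑-cong []       f≗g = refl
  ∑-cong (x ∷ xs) f≗g = cong₂ _+_ (f≗g x) (∑-cong xs f≗g)

  ∑-mono-≤ : ∀ (xs : List A) {f g : A → ℕ} → (∀ x → f x ≤ g x) → ∑ xs f ≤ ∑ xs g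
  ∑-mono-≤ []       f≤g = z≤n
  ∑-mono-≤ (x ∷ xs) f≤g = ℕ.+-mono-≤ (f≤g x) (∑-mono-≤ xs f≤g)

  ∑-+ : ∀ (xs : List A) (f g : A → ℕ) → ∑[ x ∈ xs ] (f x + g x) ≡ ∑ xs f + ∑ xs g
  ∑-+ []       f g = refl
  ∑-+ (x ∷ xs) f g = trans (cong₂ _+_ refl (∑-+ xs f g)) (swap (f x) (g x) _ _)
    where
    swap : ∀ a b c d → a + b + (c + d) ≡ a + c + (b + d)
    swap = ℕ-Solver.solve-∀

  ∑-*ˡ : ∀ (xs : List A) c (f : A → ℕ) → ∑[ x ∈ xs ] (c * f x) ≡ c * ∑ xs f
  ∑-*ˡ []       c f = sym (ℕ.*-zeroʳ c)
  ∑-*ˡ (x ∷ xs) c f = trans (cong₂ _+_ refl (∑-*ˡ xs c f)) (sym (ℕ.*-distribˡ-+ c (f x) _))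

  ∑-++ : ∀ (xs ys : List A) (f : A → ℕ) → ∑ (xs ++ ys) f ≡ ∑ xs f + ∑ ys f
  ∑-++ xs ys f = trans (cong sum (map-++ f xs ys)) (sum-++ (map f xs) (map f ys))

  ∑-concatMap : ∀ {B : Set} (g : B → List A) (ys : List B) (f : A → ℕ) →
                ∑ (concatMap g ys) f ≡ ∑[ y ∈ ys ] ∑ (g y) f
  ∑-concatMap g []       f = refl
  ∑-concatMap g (y ∷ ys) f = trans (∑-++ (g y) _ f) (cong₂ _+_ refl (∑-concatMap g ys f))

  ∑-map : ∀ {B : Set} (g : B → A) (ys : List B) (f : A → ℕ) → ∑ (map g ys) f ≡ ∑[ y ∈ ys ] f (g y)
  ∑-map g []       f = refl
  ∑-map g (y ∷ ys) f = cong₂ _+_ refl (∑-map g ys f)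

  length-filter≡∑ : ∀ {p} {P : Pred A p} (P? : Decidable P) xs →
                    length (filter P? xs) ≡ ∑[ x ∈ xs ] toℕ (does (P? x))
  length-filter≡∑ P? []       = refl
  length-filter≡∑ P? (x ∷ xs) with does (P? x)
  ... | true  = cong suc (length-filter≡∑ P? xs)
  ... | false = length-filter≡∑ P? xs

∑-allStr-suc : ∀ n (f : Str (suc n) → ℕ) →
               ∑ (allStr (suc n)) f ≡ ∑[ v ∈ allStr n ] (f (false ∷ v) + f (true ∷ v))
∑-allStr-suc n f = trans (∑-concatMap _ (allStr n) f)
  (∑-cong (allStr n) (λ v → cong₂ _+_ refl (ℕ.+-identityʳ (f (true ∷ v)))))

∑-allStr-const : ∀ n c → ∑[ v ∈ allStr n ] c ≡ 2 ^ n * c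
∑-allStr-const zero    c = refl
∑-allStr-const (suc n) c = begin
  ∑[ v ∈ allStr (suc n) ] c  ≡⟨ ∑-allStr-suc n (λ _ → c) ⟩
  ∑[ v ∈ allStr n ] (c + c)  ≡⟨ ∑-allStr-const n (c + c) ⟩
  2 ^ n * (c + c)            ≡⟨ double (2 ^ n) c ⟩
  2 * 2 ^ n * c              ∎
  where
  open ≡-Reasoning
  double : ∀ m c → m * (c + c) ≡ 2 * m * c
  double = ℕ-Solver.solve-∀

-- The head of comb (s ∷ S) (x ∷ w) (flipOn (m ∷ M) (y ∷ z)).
combBit : Bool → Bool → Bool → Bool → Bool
combBit s m x y = if s then (if m then not y else y) else x

∑-combBit : ∀ (f : Bool → ℕ) s m →
    (f (combBit s m false false) + f (combBit s m false true))
  + (f (combBit s m true false) + f (combBit s m true true))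
  ≡ (f false + f true) + (f false + f true)
∑-combBit f false m     = swap (f false) (f true)
  where
  swap : ∀ a b → a + a + (b + b) ≡ a + b + (a + b)
  swap = ℕ-Solver.solve-∀
∑-combBit f true  false = refl
∑-combBit f true  true  = cong₂ _+_ (ℕ.+-comm (f true) (f false)) (ℕ.+-comm (f true) (f false))

∑-comb-flipOn : ∀ n (S M : Block n) (f : Str n → ℕ) →
  ∑[ w ∈ allStr n ] ∑[ z ∈ allStr n ] f (comb S w (flipOn M z)) ≡ 2 ^ n * ∑ (allStr n) f
∑-comb-flipOn zero    []      []      f = refl
∑-comb-flipOn (suc n) (s ∷ S) (m ∷ M) f = begin
    ∑[ w ∈ allStr (suc n) ] ∑[ z ∈ allStr (suc n) ] f (comb (s ∷ S) w (flipOn (m ∷ M) z))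
  ≡⟨ ∑-allStr-suc n _ ⟩
    ∑[ w ∈ A ] (∑[ z ∈ allStr (suc n) ] f (comb (s ∷ S) (false ∷ w) (flipOn (m ∷ M) z))
                      + ∑[ z ∈ allStr (suc n) ] f (comb (s ∷ S) (true ∷ w) (flipOn (m ∷ M) z)))
  ≡⟨ ∑-cong (A) (λ w → cong₂ _+_ (∑-allStr-suc n _) (∑-allStr-suc n _)) ⟩
    ∑[ w ∈ A ] (∑[ z ∈ A ] (F false false w z + F false true w z) + ∑[ z ∈ A ] (F true false w z + F true true w z))
  ≡⟨ ∑-cong (A) (λ w → sym (∑-+ (A) _ _)) ⟩
    ∑[ w ∈ A ] ∑[ z ∈ A ] ((F false false w z + F false true w z) + (F true false w z + F true true w z))
  ≡⟨ ∑-cong (A) (λ w → ∑-cong (A) (λ z → ∑-combBit (λ b → f (b ∷ r w z)) s m)) ⟩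
    ∑[ w ∈ A ] ∑[ z ∈ A ] (g (r w z) + g (r w z))
  ≡⟨ ∑-cong (A) (λ w → ∑-+ (A) _ _) ⟩
    ∑[ w ∈ A ] (∑[ z ∈ A ] g (r w z) + ∑[ z ∈ A ] g (r w z))
  ≡⟨ ∑-+ (A) _ _ ⟩
    ∑[ w ∈ A ] ∑[ z ∈ A ] g (r w z) + ∑[ w ∈ A ] ∑[ z ∈ A ] g (r w z)
  ≡⟨ cong (λ t → t + t) (∑-comb-flipOn n S M g) ⟩
    2 ^ n * ∑ (A) g + 2 ^ n * ∑ (A) g
  ≡⟨ double (2 ^ n) _ ⟩
    2 ^ suc n * ∑ (A) g
  ≡⟨ cong (2 ^ suc n *_) (∑-allStr-suc n f) ⟨
    2 ^ suc n * ∑ (allStr (suc n)) f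
  ∎
  where
  open ≡-Reasoning
  A = allStr n
  r : Str n → Str n → Str n
  r w z = comb S w (flipOn M z)
  F : Bool → Bool → Str n → Str n → ℕ
  F x y w z = f (combBit s m x y ∷ r w z)
  g : Str n → ℕ
  g v = f (false ∷ v) + f (true ∷ v)
  double : ∀ m t → m * t + m * t ≡ 2 * m * t
  double = ℕ-Solver.solve-∀

flipOn-none : ∀ {n} (z : Str n) → flipOn (replicate n false) z ≡ z
flipOn-none []      = refl
flipOn-none (x ∷ z) = cong (x ∷_) (flipOn-none z)

∑-comb : ∀ n (S : Block n) (f : Str n → ℕ) →
  ∑[ w ∈ allStr n ] ∑[ z ∈ allStr n ] f (comb S w z) ≡ 2 ^ n * ∑ (allStr n) f
∑-comb n S f = trans
  (∑-cong (allStr n) (λ w → ∑-cong (allStr n) (λ z → cong (λ y → f (comb S w y)) (sym (flipOn-none z)))))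
  (∑-comb-flipOn n S (replicate n false) f)

Seed : ℕ → Set
Seed n = Str n × Str n × Str n × Str n

∑-allSeeds : ∀ n (f : Seed n → ℕ) →
  ∑ (allSeeds n) f
  ≡ ∑[ w ∈ allStr n ] ∑[ z ∈ allStr n ] ∑[ w' ∈ allStr n ] ∑[ z' ∈ allStr n ] f (w , z , w' , z')
∑-allSeeds n f = trans (∑-concatMap _ A f)
  (∑-cong A (λ w → trans (∑-concatMap _ A f)
    (∑-cong A (λ z → trans (∑-concatMap _ A f)
      (∑-cong A (λ w' → ∑-map _ A f))))))
  where
  A = allStr n

∑-allSeeds-front : ∀ n (f : Str n → Str n → ℕ) →
  ∑[ (w , z , _ , _) ∈ allSeeds n ] f w z ≡ 2 ^ n * (2 ^ n * ∑[ w ∈ allStr n ] ∑[ z ∈ allStr n ] f w z)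
∑-allSeeds-front n f = begin
    ∑[ (w , z , _ , _) ∈ allSeeds n ] f w z
  ≡⟨ ∑-allSeeds n _ ⟩
    ∑[ w ∈ A ] ∑[ z ∈ A ] ∑[ w' ∈ A ] ∑[ z' ∈ A ] f w z
  ≡⟨ ∑-cong A (λ w → ∑-cong A (λ z →
       trans (∑-cong A (λ w' → ∑-allStr-const n _)) (∑-allStr-const n _))) ⟩
    ∑[ w ∈ A ] ∑[ z ∈ A ] (N * (N * f w z))
  ≡⟨ ∑-cong A (λ w → trans (∑-*ˡ A N _) (cong (N *_) (∑-*ˡ A N _))) ⟩
    ∑[ w ∈ A ] (N * (N * ∑[ z ∈ A ] f w z))
  ≡⟨ trans (∑-*ˡ A N _) (cong (N *_) (∑-*ˡ A N _)) ⟩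
    N * (N * ∑[ w ∈ A ] ∑[ z ∈ A ] f w z)
  ∎
  where
  open ≡-Reasoning
  A = allStr n
  N = 2 ^ n

∑-allSeeds-back : ∀ n (f : Str n → Str n → ℕ) →
  ∑[ (_ , _ , w' , z') ∈ allSeeds n ] f w' z' ≡ 2 ^ n * (2 ^ n * ∑[ w ∈ allStr n ] ∑[ z ∈ allStr n ] f w z)
∑-allSeeds-back n f =
  trans (∑-allSeeds n _) (trans (∑-cong (allStr n) (λ w → ∑-allStr-const n _)) (∑-allStr-const n _))

∑-allSeeds-1 : ∀ n → ∑[ s ∈ allSeeds n ] 1 ≡ (2 ^ n) ^ 4
∑-allSeeds-1 n = trans (∑-allSeeds-back n (λ _ _ → 1))
  (cong (λ t → 2 ^ n * (2 ^ n * t))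
        (trans (∑-cong (allStr n) (λ _ → ∑-allStr-const n 1)) (∑-allStr-const n _)))

module _ {n : ℕ} (S : Block n) {i : Fin n} where

  lookup-comb-∈ : ∀ w z → lookup S i ≡ true → lookup (comb S w z) i ≡ lookup z i
  lookup-comb-∈ w z i∈S rewrite lookup∘tabulate (λ j → if lookup S j then lookup z j else lookup w j) i
                              | i∈S = refl

  lookup-comb-∉ : ∀ w z → lookup S i ≡ false → lookup (comb S w z) i ≡ lookup w i
  lookup-comb-∉ w z i∉S rewrite lookup∘tabulate (λ j → if lookup S j then lookup z j else lookup w j) i
                              | i∉S = refl

  lookup-flipOn-∈ : ∀ z → lookup S i ≡ true → lookup (flipOn S z) i ≡ not (lookup z i)
  lookup-flipOn-∈ z i∈S rewrite lookup∘tabulate (λ j → if lookup S j then not (lookup z j) else lookup z j) i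
                              | i∈S = refl

  lookup-compl : lookup S i ≡ false → lookup (compl S) i ≡ true
  lookup-compl i∉S rewrite lookup-map i not S | i∉S = refl

literal-cong : ∀ {n} (i : Fin n) pos {x y : Str n} →
               lookup x i ≡ lookup y i → literal i pos x ≡ literal i pos y
literal-cong i true  eq = eq
literal-cong i false eq = cong not eq

literal-not : ∀ {n} (i : Fin n) pos {x y : Str n} →
              lookup x i ≡ not (lookup y i) → literal i pos x ≡ not (literal i pos y)
literal-not i true  eq = eq
literal-not i false eq = cong not eq

module _ {n : ℕ} (S : Block n) {i : Fin n} (pos : Bool) (w z : Str n) where

  literal-comb-flipOn-∈ : lookup S i ≡ true →
    literal i pos (comb S w (flipOn S z)) ≡ not (literal i pos (comb S w z))
  literal-comb-flipOn-∈ i∈S = literal-not i pos (begin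
    lookup (comb S w (flipOn S z)) i  ≡⟨ lookup-comb-∈ S w (flipOn S z) i∈S ⟩
    lookup (flipOn S z) i             ≡⟨ lookup-flipOn-∈ S z i∈S ⟩
    not (lookup z i)                  ≡⟨ cong not (lookup-comb-∈ S w z i∈S) ⟨
    not (lookup (comb S w z) i)       ∎)
    where open ≡-Reasoning

  literal-comb-flipOn-∉ : lookup S i ≡ false →
    literal i pos (comb S w (flipOn S z)) ≡ literal i pos (comb S w z)
  literal-comb-flipOn-∉ i∉S =
    literal-cong i pos (trans (lookup-comb-∉ S w (flipOn S z) i∉S) (sym (lookup-comb-∉ S w z i∉S)))

==-refl : ∀ x → (x == x) ≡ true
==-refl false = refl
==-refl true  = refl

agreeOff-comb : ∀ {n} (S : Block n) (w z y : Str n) → agreeOff S (comb S w z) (comb S w y) ≡ true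
agreeOff-comb []          []      []      []      = refl
agreeOff-comb (true  ∷ S) (x ∷ w) (_ ∷ z) (_ ∷ y) = agreeOff-comb S w z y
agreeOff-comb (false ∷ S) (x ∷ w) (_ ∷ z) (_ ∷ y) rewrite ==-refl x = agreeOff-comb S w z y

module _ {n : ℕ} (P : Block n) where

  query₁ query₂ query₃ query₄ : Seed n → Str n
  query₁ (w , z , _ , _) = comb P w z
  query₂ (w , z , _ , _) = comb P w (flipOn P z)
  query₃ (_ , _ , w' , z') = comb (compl P) w' z'
  query₄ (_ , _ , w' , z') = comb (compl P) w' (flipOn (compl P) z')

module _ {n : ℕ} (g : Str n → Bool) (P : Block n) where

  run : Seed n → Outcome n
  run (w , z , w' , z') = whereIsTheLiteral g P w z w' z'

  returnsDistP-if : ∀ c c' {a a' b b' : Str n} →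
    returnsDistP g P (if c then pairP a a' else (if c' then pairQ b b' else fail)) ≡ c ∧ isDistPair g P a a'
  returnsDistP-if true  _     = refl
  returnsDistP-if false true  = refl
  returnsDistP-if false false = refl

  returnsDistQ-if : ∀ c c' {a a' b b' : Str n} →
    returnsDistQ g P (if c then pairP a a' else (if c' then pairQ b b' else fail))
    ≡ not c ∧ (c' ∧ isDistPair g (compl P) b b')
  returnsDistQ-if true  _     = refl
  returnsDistQ-if false true  = refl
  returnsDistQ-if false false = refl

  returnsDistP-run : ∀ s → returnsDistP g P (run s) ≡ g (query₁ P s) xor g (query₂ P s)
  returnsDistP-run s@(w , z , _ , _) = begin
    returnsDistP g P (run s)                        ≡⟨ returnsDistP-if c _ ⟩
    c ∧ (agreeOff P (query₁ P s) (query₂ P s) ∧ c)  ≡⟨ cong (λ t → c ∧ (t ∧ c)) (agreeOff-comb P w z (flipOn P z)) ⟩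
    c ∧ c                                           ≡⟨ ∧-idem c ⟩
    c                                               ≡⟨ not-== (g (query₁ P s)) (g (query₂ P s)) ⟩
    g (query₁ P s) xor g (query₂ P s)               ∎
    where
    open ≡-Reasoning
    c = not (g (query₁ P s) == g (query₂ P s))

  returnsDistQ-run : ∀ s → returnsDistQ g P (run s)
                           ≡ not (g (query₁ P s) xor g (query₂ P s)) ∧ (g (query₃ P s) xor g (query₄ P s))
  returnsDistQ-run s@(_ , _ , w' , z') = begin
      returnsDistQ g P (run s)
    ≡⟨ returnsDistQ-if c d ⟩
      not c ∧ (d ∧ (agreeOff (compl P) (query₃ P s) (query₄ P s) ∧ d))
    ≡⟨ cong (λ t → not c ∧ (d ∧ (t ∧ d))) (agreeOff-comb (compl P) w' z' (flipOn (compl P) z')) ⟩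
      not c ∧ (d ∧ d)
    ≡⟨ cong₂ (λ u v → not u ∧ v) (not-== (g (query₁ P s)) (g (query₂ P s)))
                                 (trans (∧-idem d) (not-== (g (query₃ P s)) (g (query₄ P s)))) ⟩
      not (g (query₁ P s) xor g (query₂ P s)) ∧ (g (query₃ P s) xor g (query₄ P s))
    ∎
    where
    open ≡-Reasoning
    c = not (g (query₁ P s) == g (query₂ P s))
    d = not (g (query₃ P s) == g (query₄ P s))

  countSeeds≡∑ : ∀ (E : Outcome n → Bool) → countSeeds n E g P ≡ ∑[ s ∈ allSeeds n ] toℕ (E (run s))
  countSeeds≡∑ E = trans (length-filter≡∑ _ (allSeeds n))
                         (∑-cong (allSeeds n) (λ s → cong toℕ (does-≟-true (E (run s)))))

module _ {n : ℕ} (g h : Str n → Bool) where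

  mismatch : Str n → ℕ
  mismatch x = toℕ (g x xor h x)

  mismatches : ℕ
  mismatches = ∑ (allStr n) mismatch

  length-filter-≢ : length (filter (λ x → g x ≟ᵇ not (h x)) (allStr n)) ≡ mismatches
  length-filter-≢ = trans (length-filter≡∑ _ (allStr n))
                          (∑-cong (allStr n) (λ x → cong toℕ (does-≟-not (g x) (h x))))

  queryMismatches : Block n → Seed n → ℕ
  queryMismatches P s = mismatch (query₁ P s) + mismatch (query₂ P s)
                      + (mismatch (query₃ P s) + mismatch (query₄ P s))

  ∑-queryMismatches : ∀ P → ∑ (allSeeds n) (queryMismatches P) ≡ 4 * ((2 ^ n) ^ 3 * mismatches)
  ∑-queryMismatches P = begin
      ∑ (allSeeds n) (queryMismatches P)
    ≡⟨ trans (∑-+ (allSeeds n) _ _) (cong₂ _+_ (∑-+ (allSeeds n) _ _) (∑-+ (allSeeds n) _ _)) ⟩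
      ∑ (allSeeds n) (λ s → mismatch (query₁ P s)) + ∑ (allSeeds n) (λ s → mismatch (query₂ P s))
      + (∑ (allSeeds n) (λ s → mismatch (query₃ P s)) + ∑ (allSeeds n) (λ s → mismatch (query₄ P s)))
    ≡⟨ cong₂ _+_ (cong₂ _+_ (uniform (∑-allSeeds-front n _) (∑-comb n P mismatch))
                            (uniform (∑-allSeeds-front n _) (∑-comb-flipOn n P P mismatch)))
                 (cong₂ _+_ (uniform (∑-allSeeds-back n _) (∑-comb n (compl P) mismatch))
                            (uniform (∑-allSeeds-back n _) (∑-comb-flipOn n (compl P) (compl P) mismatch))) ⟩
      N³D + N³D + (N³D + N³D)
    ≡⟨ four N mismatches ⟩
      4 * (N ^ 3 * mismatches)
    ∎
    where
    open ≡-Reasoning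
    N = 2 ^ n
    N³D = N * (N * (N * mismatches))
    uniform : ∀ {t u} → t ≡ N * (N * u) → u ≡ N * mismatches → t ≡ N³D
    uniform t≡ u≡ = trans t≡ (cong (λ v → N * (N * v)) u≡)
    four : ∀ m d → m * (m * (m * d)) + m * (m * (m * d)) + (m * (m * (m * d)) + m * (m * (m * d)))
                   ≡ 4 * (m * (m * (m * 1)) * d)
    four = ℕ-Solver.solve-∀

countSeeds-union-bound : ∀ n (E : Outcome n → Bool) (g h : Str n → Bool) (P : Block n) →
  (∀ s → 1 ≤ toℕ (E (run g P s)) + queryMismatches g h P s) →
  2 ^ n * (2 ^ n) ^ 3 ≤ countSeeds n E g P + 4 * ((2 ^ n) ^ 3 * mismatches g h)
countSeeds-union-bound n E g h P cover = begin
    (2 ^ n) ^ 4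
  ≡⟨ ∑-allSeeds-1 n ⟨
    ∑[ s ∈ allSeeds n ] 1
  ≤⟨ ∑-mono-≤ (allSeeds n) cover ⟩
    ∑[ s ∈ allSeeds n ] (toℕ (E (run g P s)) + queryMismatches g h P s)
  ≡⟨ ∑-+ (allSeeds n) _ _ ⟩
    ∑[ s ∈ allSeeds n ] toℕ (E (run g P s)) + ∑ (allSeeds n) (queryMismatches g h P)
  ≡⟨ cong₂ _+_ (sym (countSeeds≡∑ g P E)) (∑-queryMismatches g h P) ⟩
    countSeeds n E g P + 4 * ((2 ^ n) ^ 3 * mismatches g h)
  ∎
  where open ℕ.≤-Reasoning

not-∧-cover : ∀ c d {e₁ e₂} → toℕ c ≤ e₁ → 1 ≤ toℕ d + e₂ → 1 ≤ toℕ (not c ∧ d) + (e₁ + e₂)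
not-∧-cover true  d {e₁} {e₂} c≤e₁ _  = ℕ.≤-trans c≤e₁ (ℕ.m≤m+n e₁ e₂)
not-∧-cover false d {e₁} {e₂} _    d≥ = ℕ.≤-trans d≥ (ℕ.+-monoʳ-≤ (toℕ d) (ℕ.m≤n+m e₂ e₁))

module _ {n : ℕ} (g : Str n → Bool) (P : Block n) {i : Fin n} (pos : Bool) where

  private
    h : Str n → Bool
    h = literal i pos

    m : Str n → ℕ
    m = mismatch g h

  flipped-pair-cover : ∀ (S : Block n) → lookup S i ≡ true → ∀ w z →
    1 ≤ toℕ (g (comb S w z) xor g (comb S w (flipOn S z))) + (m (comb S w z) + m (comb S w (flipOn S z)))
  flipped-pair-cover S i∈S w z = begin
    1                                   ≤⟨ xor-cover (g a) (g a') (h a) ⟩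
    toℕ (g a xor g a') + m a + toℕ (g a' xor not (h a))
      ≡⟨ cong (λ t → toℕ (g a xor g a') + m a + toℕ (g a' xor t)) (literal-comb-flipOn-∈ S pos w z i∈S) ⟨
    toℕ (g a xor g a') + m a + m a'     ≡⟨ ℕ.+-assoc (toℕ (g a xor g a')) (m a) (m a') ⟩
    toℕ (g a xor g a') + (m a + m a')   ∎
    where
    open ℕ.≤-Reasoning
    a = comb S w z
    a' = comb S w (flipOn S z)

  returnsDistP-cover : lookup P i ≡ true → ∀ s →
                       1 ≤ toℕ (returnsDistP g P (run g P s)) + queryMismatches g h P s
  returnsDistP-cover i∈P s@(w , z , _ , _) = begin
    1                                                    ≤⟨ flipped-pair-cover P i∈P w z ⟩
    toℕ (g q₁ xor g q₂) + (m q₁ + m q₂)                  ≤⟨ ℕ.+-monoʳ-≤ (toℕ (g q₁ xor g q₂)) (ℕ.m≤m+n _ _) ⟩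
    toℕ (g q₁ xor g q₂) + qm                             ≡⟨ cong (λ t → toℕ t + qm) (returnsDistP-run g P s) ⟨
    toℕ (returnsDistP g P (run g P s)) + qm              ∎
    where
    open ℕ.≤-Reasoning
    qm = queryMismatches g h P s
    q₁ = query₁ P s
    q₂ = query₂ P s

  returnsDistQ-cover : lookup P i ≡ false → ∀ s →
                       1 ≤ toℕ (returnsDistQ g P (run g P s)) + queryMismatches g h P s
  returnsDistQ-cover i∉P s@(w , z , w' , z') =
    subst (λ t → 1 ≤ toℕ t + queryMismatches g h P s) (sym (returnsDistQ-run g P s))
      (not-∧-cover (g q₁ xor g q₂) (g q₃ xor g q₄) unflipped
                   (flipped-pair-cover (compl P) (lookup-compl P i∉P) w' z'))
    where
    q₁ = query₁ P s
    q₂ = query₂ P s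
    q₃ = query₃ P s
    q₄ = query₄ P s
    unflipped : toℕ (g q₁ xor g q₂) ≤ m q₁ + m q₂
    unflipped = subst (λ t → toℕ (g q₁ xor g q₂) ≤ m q₁ + toℕ (g q₂ xor t))
                      (sym (literal-comb-flipOn-∉ P pos w z i∉P)) (xor-triangle (g q₁) (g q₂) (h q₁))

*≤*-ℕ : ∀ {a b d e} → a * suc e ≤ b * suc d → + a ℚᵘ./ suc d ℚᵘ.≤ + b ℚᵘ./ suc e
*≤*-ℕ {a} {b} {d} {e} h = *≤* (subst₂ ℤ._≤_ (ℤ.pos-* a (suc e)) (ℤ.pos-* b (suc d)) (ℤ.+≤+ h))

/-+ : ∀ i j d → i ℚᵘ./ suc d ℚᵘ.+ j ℚᵘ./ suc d ℚᵘ.≃ (i ℤ.+ j) ℚᵘ./ suc d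
/-+ i j d = *≡* (trans (distrib i j (+ suc d)) (cong ((i ℤ.+ j) ℤ.*_) (sym (ℤ.pos-* (suc d) (suc d)))))
  where
  distrib : ∀ i j n → (i ℤ.* n ℤ.+ j ℤ.* n) ℤ.* n ≡ (i ℤ.+ j) ℤ.* (n ℤ.* n)
  distrib = ℤ-Solver.solve-∀

kMb/dM≃k*[b/d] : ∀ k b d M →
  + (k * (suc M * b)) ℚᵘ./ (suc d * suc M) ℚᵘ.≃ (+ k ℚᵘ./ 1) ℚᵘ.* (+ b ℚᵘ./ suc d)
kMb/dM≃k*[b/d] k b d M = *≡* (begin
  + (k * (suc M * b)) ℤ.* + (1 * suc d)  ≡⟨ ℤ.pos-* (k * (suc M * b)) (1 * suc d) ⟨
  + (k * (suc M * b) * (1 * suc d))      ≡⟨ cong +_ (rearrange k b (suc d) (suc M)) ⟩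
  + (k * b * (suc d * suc M))            ≡⟨ ℤ.pos-* (k * b) (suc d * suc M) ⟩
  + (k * b) ℤ.* + (suc d * suc M)        ≡⟨ cong (ℤ._* + (suc d * suc M)) (ℤ.pos-* k b) ⟩
  + k ℤ.* + b ℤ.* + (suc d * suc M)      ∎)
  where
  open ≡-Reasoning
  rearrange : ∀ k b d m → k * (m * b) * (1 * d) ≡ k * b * (d * m)
  rearrange = ℕ-Solver.solve-∀

1≤a/[d*M]+k*[b/d] : ∀ k a b d M → suc d * suc M ≤ a + k * (suc M * b) →
  1ℚᵘ ℚᵘ.≤ + a ℚᵘ./ (suc d * suc M) ℚᵘ.+ (+ k ℚᵘ./ 1) ℚᵘ.* (+ b ℚᵘ./ suc d)
1≤a/[d*M]+k*[b/d] k a b d M dM≤ = begin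
    1ℚᵘ
  ≤⟨ *≤*-ℕ (subst₂ _≤_ (sym (ℕ.*-identityˡ _)) (sym (ℕ.*-identityʳ _)) dM≤) ⟩
    + (a + k * (suc M * b)) ℚᵘ./ (suc d * suc M)
  ≃⟨ /-+ (+ a) (+ (k * (suc M * b))) _ ⟨
    + a ℚᵘ./ (suc d * suc M) ℚᵘ.+ + (k * (suc M * b)) ℚᵘ./ (suc d * suc M)
  ≃⟨ ℚᵘ.+-congʳ (+ a ℚᵘ./ (suc d * suc M)) (kMb/dM≃k*[b/d] k b d M) ⟩
    + a ℚᵘ./ (suc d * suc M) ℚᵘ.+ (+ k ℚᵘ./ 1) ℚᵘ.* (+ b ℚᵘ./ suc d)
  ∎
  where open ℚᵘ.≤-Reasoning

p≤q+r⇒p-r≤q : ∀ {p q r} → p ℚᵘ.≤ q ℚᵘ.+ r → p ℚᵘ.- r ℚᵘ.≤ q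
p≤q+r⇒p-r≤q {p} {q} {r} h = begin
  p ℚᵘ.- r            ≤⟨ ℚᵘ.+-monoˡ-≤ (ℚᵘ.- r) h ⟩
  q ℚᵘ.+ r ℚᵘ.- r     ≃⟨ ℚᵘ.+-assoc q r (ℚᵘ.- r) ⟩
  q ℚᵘ.+ (r ℚᵘ.- r)   ≃⟨ ℚᵘ.+-congʳ q (ℚᵘ.+-inverseʳ r) ⟩
  q ℚᵘ.+ ℚᵘ.0ℚᵘ       ≃⟨ ℚᵘ.+-identityʳ q ⟩
  q                   ∎
  where open ℚᵘ.≤-Reasoning

toℚᵘ-/ : ∀ i n .{{_ : NonZero n}} → toℚᵘ (i ℚ./ n) ℚᵘ.≃ i ℚᵘ./ n
toℚᵘ-/ i (suc n) = ℚ.toℚᵘ-fromℚᵘ (mkℚᵘ i n)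

1-k*γ≤a/[d*M] : ∀ (γ : ℚ) (k a b d M : ℕ) .{{_ : NonZero d}} .{{_ : NonZero M}} →
  d * M ≤ a + k * (M * b) → + b ℚ./ d ℚ.≤ γ →
  1ℚ ℚ.- (+ k ℚ./ 1) ℚ.* γ ℚ.≤ (+ a ℚ./ (d * M)) {{ℕ.m*n≢0 d M}}
1-k*γ≤a/[d*M] γ k a b (suc d) (suc M) dM≤ b/d≤γ = ℚ.toℚᵘ-cancel-≤ (begin
    toℚᵘ (1ℚ ℚ.- kγ)
  ≃⟨ ℚ.toℚᵘ-homo-+ 1ℚ (ℚ.- kγ) ⟩
    1ℚᵘ ℚᵘ.+ toℚᵘ (ℚ.- kγ)
  ≃⟨ ℚᵘ.+-congʳ 1ℚᵘ (ℚ.toℚᵘ-homo‿- kγ) ⟩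
    1ℚᵘ ℚᵘ.- toℚᵘ kγ
  ≃⟨ ℚᵘ.+-congʳ 1ℚᵘ (ℚᵘ.-‿cong (ℚᵘ.≃-trans (ℚ.toℚᵘ-homo-* (+ k ℚ./ 1) γ)
                                           (ℚᵘ.*-congʳ (toℚᵘ-/ (+ k) 1)))) ⟩
    1ℚᵘ ℚᵘ.- k̂ ℚᵘ.* toℚᵘ γ
  ≤⟨ ℚᵘ.+-monoʳ-≤ 1ℚᵘ (ℚᵘ.neg-mono-≤ (ℚᵘ.*-monoʳ-≤-nonNeg k̂ b/d≤γᵘ)) ⟩
    1ℚᵘ ℚᵘ.- k̂ ℚᵘ.* (+ b ℚᵘ./ suc d)
  ≤⟨ p≤q+r⇒p-r≤q {r = k̂ ℚᵘ.* (+ b ℚᵘ./ suc d)} (1≤a/[d*M]+k*[b/d] k a b d M dM≤) ⟩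
    + a ℚᵘ./ (suc d * suc M)
  ≃⟨ toℚᵘ-/ (+ a) (suc d * suc M) ⟨
    toℚᵘ (+ a ℚ./ (suc d * suc M))
  ∎)
  where
  open ℚᵘ.≤-Reasoning
  kγ = (+ k ℚ./ 1) ℚ.* γ
  k̂ = + k ℚᵘ./ 1
  b/d≤γᵘ : + b ℚᵘ./ suc d ℚᵘ.≤ toℚᵘ γ
  b/d≤γᵘ = ℚᵘ.≤-respˡ-≃ (toℚᵘ-/ (+ b) (suc d)) (ℚ.toℚᵘ-mono-≤ b/d≤γ)

lemma9 : (n : ℕ) → 1 ≤ n → (P : Block n) → (g : Str n → Bool) → (γ : ℚ) →
         (i : Fin n) → (pos : Bool) → close n γ g (literal i pos) →
         (lookup P i ≡ true → 1ℚ ℚ.- ((+ 4 ℚ./ 1) ℚ.* γ) ℚ.≤ probSeeds n (returnsDistP g P) g P)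
         × (lookup P i ≡ false → 1ℚ ℚ.- ((+ 4 ℚ./ 1) ℚ.* γ) ℚ.≤ probSeeds n (returnsDistQ g P) g P)
lemma9 n _ P g γ i pos g≈h =
  (λ i∈P → bound (returnsDistP g P) (returnsDistP-cover g P pos i∈P)) ,
  (λ i∉P → bound (returnsDistQ g P) (returnsDistQ-cover g P pos i∉P))
  where
  h = literal i pos
  N = 2 ^ n
  instance
    N≢0 : NonZero N
    N≢0 = ℕ.m^n≢0 2 n
    N³≢0 : NonZero (N ^ 3)
    N³≢0 = ℕ.m^n≢0 N 3
    N⁴≢0 : NonZero (N * N ^ 3)
    N⁴≢0 = ℕ.m^n≢0 N 4
    2^[4n]≢0 : NonZero (2 ^ (4 * n))
    2^[4n]≢0 = ℕ.m^n≢0 2 (4 * n)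
  mismatches/N≤γ : + mismatches g h ℚ./ N ℚ.≤ γ
  mismatches/N≤γ = subst (ℚ._≤ γ) (ℚ./-cong (cong +_ (length-filter-≢ g h)) refl) g≈h
  N⁴≡2^[4n] : N * N ^ 3 ≡ 2 ^ (4 * n)
  N⁴≡2^[4n] = trans (ℕ.^-*-assoc 2 n 4) (cong (2 ^_) (ℕ.*-comm n 4))
  bound : ∀ E → (∀ s → 1 ≤ toℕ (E (run g P s)) + queryMismatches g h P s) →
          1ℚ ℚ.- ((+ 4 ℚ./ 1) ℚ.* γ) ℚ.≤ probSeeds n E g P
  bound E cover = subst (1ℚ ℚ.- ((+ 4 ℚ./ 1) ℚ.* γ) ℚ.≤_) (ℚ./-cong {+ countSeeds n E g P} refl N⁴≡2^[4n])
    (1-k*γ≤a/[d*M] γ 4 (countSeeds n E g P) (mismatches g h) N (N ^ 3)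
                   (countSeeds-union-bound n E g h P cover) mismatches/N≤γ)
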